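{- Let $r,q$ be integers greater than $1$ with $r\le q^{r-3}$, let $P$ be a set of $rq$ points, identified with $\{1,\dots,rq\}$, and let $G_1,\dots,G_r$ be a partition of $P$ into groups of size $q$. Let $\mathcal{B}=\{B\subseteq P: |B\cap G_i|=1 \text{ for all } i\}$ and, for $i\in P$, $\mathcal{B}_i=\{B\in\mathcal{B}: i\in B\}$ (so $|\mathcal{B}_i|=q^{r-1}$). Put $w=q^{r-2}$, and for each $i\in P$ fix a partition $\mathcal{B}_i=\mathcal{B}_{i,1}\cup\cdots\cup\mathcal{B}_{i,w}$ into $w$ pairwise disjoint parts, each of size $q$, such that $B\cap C=\{i\}$ for any two distinct $B,C$ in the same part $\mathcal{B}_{i,j}$. Let $\pi:\{1,\dots,rq\}\to\{1,\dots,w\}$ be any injective map, and for $g\in G_h$ let $\mathcal{C}^{\pi}_g=\bigcup_{i\in G_h\setminus\{g\}}\mathcal{B}_{i,\pi(i)}$. Let $D$ be the directed graph with vertex set $\{(g,B): g\in P,\ B\in\mathcal{C}^{\pi}_g\}$ and an arc $(g,B)\to(g',B')$ if and only if $g\in B'$. Then $D$ is a directed strongly regular graph with parameters \[(v,k,t,\lambda,\mu)=\big(rq^2(q-1),\ rq(q-1),\ rq-r+1,\ rq-r-q+1,\ rq-r+1\big).\]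
   Context: A directed strongly regular graph with parameters $(v,k,t,\lambda,\mu)$ is a loopless directed graph on $v$ vertices with adjacency matrix $A$ satisfying $AJ=JA=kJ$ and $A^2=tI+\lambda A+\mu(J-I-A)$, where $I$ is the identity and $J$ the all-ones matrix. Equivalently: every vertex has in- and out-degree $k$; every vertex $x$ has exactly $t$ out-neighbours that are also in-neighbours of $x$; and for distinct vertices $x,y$ the number of directed paths of length two from $x$ to $y$ is $\lambda$ if $x\to y$ is an arc and $\mu$ otherwise. -}

module Defs where

open import Data.Nat using (ℕ)
open import Data.Fin using (Fin; _≟_)
open import Data.Fin.Subset using (Subset; _∈_; _∩_; ∣_∣; ⁅_⁆)
open import Data.Vec using (tabulate)
open import Data.Product using (Σ; _×_; _,_)
open import Relation.Nullary using (¬_; does)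
open import Relation.Nullary.Decidable using (False)
open import Relation.Binary.PropositionalEquality using (_≡_; _≢_)
open import Function.Bundles using (_↔_)

HasSize : Set → ℕ → Set
HasSize A n = Fin n ↔ A

record IsDSRG (V : Set) (_⇒_ : V → V → Set) (v k t lam mu : ℕ) : Set where
  field
    size     : HasSize V v
    loopless : ∀ x → ¬ (x ⇒ x)
    outdeg   : ∀ x → HasSize (Σ V λ y → x ⇒ y) k
    indeg    : ∀ x → HasSize (Σ V λ y → y ⇒ x) k
    mutualN  : ∀ x → HasSize (Σ V λ y → (x ⇒ y) × (y ⇒ x)) t
    pathsArc : ∀ x y → x ≢ y → x ⇒ y → HasSize (Σ V λ z → (x ⇒ z) × (z ⇒ y)) lam
    pathsNon : ∀ x y → x ≢ y → ¬ (x ⇒ y) → HasSize (Σ V λ z → (x ⇒ z) × (z ⇒ y)) mu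

module _ {n r : ℕ} (group : Fin n → Fin r) where

  Grp : Fin r → Subset n
  Grp i = tabulate (λ p → does (group p ≟ i))

  IsBlock : Subset n → Set
  IsBlock B = ∀ i → ∣ B ∩ Grp i ∣ ≡ 1

  -- partB i j k is the k-th block of the part 𝓑_{i,j}.
  -- This says: (j,k) ↦ partB i j k is a bijection Fin w × Fin q → 𝓑_i,
  -- i.e. the parts 𝓑_{i,j} = {partB i j k | k} partition 𝓑_i into w
  -- pairwise disjoint parts of size q, and distinct blocks in the same
  -- part meet exactly in {i}.
  record IsBlockPartition {w q : ℕ} (partB : Fin n → Fin w → Fin q → Subset n) : Set where
    field
      inBi      : ∀ i j k → IsBlock (partB i j k) × (i ∈ partB i j k)
      injective : ∀ i j k j' k' → partB i j k ≡ partB i j' k' → (j ≡ j') × (k ≡ k')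
      covers    : ∀ i B → IsBlock B → i ∈ B → Σ (Fin w) λ j → Σ (Fin q) λ k → B ≡ partB i j k
      meet      : ∀ i j k k' → k ≢ k' → (partB i j k ∩ partB i j k') ≡ ⁅ i ⁆

  module _ {w q : ℕ} (partB : Fin n → Fin w → Fin q → Subset n) (π : Fin n → Fin w) where

    InC : Fin n → Subset n → Set
    InC g B = Σ (Fin n) λ i → (group i ≡ group g) × False (i ≟ g)
                × Σ (Fin q) λ k → B ≡ partB i (π i) k

    DVertex : Set
    DVertex = Σ (Fin n × Subset n) λ { (g , B) → InC g B }

    DArc : DVertex → DVertex → Set
    DArc ((g , _) , _) ((_ , B') , _) = g ∈ B'

module Submission where

-- A vertex (g , B) is unfolded into its description
-- (g , i , k): a point g, another point i of g's group, and the index k of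
-- B = 𝓑_{i,π(i),k}.  Every count then reduces to three facts:
--
--   * a block meets every group in exactly one point, so it has r points;
--   * the blocks 𝓑_{i,j,1..q} of one part all contain i, contain no other
--     point of i's group, and cover every point outside that group exactly
--     once (they meet that point's group in q distinct points);
--   * hence the pairs (i , k) with g ∈ 𝓑_{i,π(i),k} number q for i = g,
--     none for the other points of g's group, and one for every other i.

open import Defs
open import Data.Nat using (ℕ; _+_; _*_; _∸_; _^_; _≤_)
open import Data.Fin using (Fin)
open import Data.Fin.Subset using (Subset; ∣_∣)
open import Relation.Binary.PropositionalEquality using (_≡_)
open import Function.Definitions using (Injective)

open import Data.Nat using (zero; suc; s≤s; z≤n)
open import Data.Nat.Properties using (*-suc; *-identityʳ; +-identityʳ; m+n∸m≡n; ≤⇒≯; n<1+n)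
open import Data.Nat.Tactic.RingSolver using (solve-∀)
open import Data.Fin using (zero; suc; punchIn; punchOut; _≟_)
open import Data.Fin.Properties
  using (+↔⊎; *↔×; 1↔⊤; punchInᵢ≢i; punchIn-punchOut; punchOut-punchIn; punchOut-cong;
         punchOut-injective; injective⇒≤; any?)
open import Data.Fin.Subset using (_∈_; _∉_; _∩_; inside; outside)
open import Data.Fin.Subset.Properties using (x∈p∩q⁺; x∈p∩q⁻; x∈⁅y⁆⇒x≡y)
open import Data.Vec using (tabulate; []; _∷_; here; there)
open import Data.Vec.Properties using ([]=⇒lookup; lookup⇒[]=; lookup∘tabulate)
open import Data.Vec.Properties.WithK using ([]=-irrelevant)
open import Data.Product using (Σ; _×_; _,_; proj₁; proj₂; ∃)
open import Data.Product.Function.Dependent.Propositional using (Σ-↔)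
open import Data.Sum using (_⊎_; inj₁; inj₂)
open import Data.Sum.Function.Propositional using (_⊎-↔_)
open import Data.Bool using (Bool; true)
open import Data.Bool.Properties using (T-irrelevant)
open import Data.Unit using (⊤; tt)
open import Data.Empty using (⊥-elim)
open import Relation.Nullary using (¬_; Dec; yes; no; does)
open import Relation.Nullary.Irrelevant using (Irrelevant)
open import Relation.Nullary.Decidable
  using (True; False; dec-true; toWitness; fromWitness; toWitnessFalse; fromWitnessFalse)
open import Relation.Unary using (Decidable)
open import Relation.Binary.Definitions using (DecidableEquality)
open import Relation.Binary.PropositionalEquality using (_≢_; refl; sym; trans; cong; subst; module ≡-Reasoning)
open import Relation.Binary.PropositionalEquality.WithK using (≡-irrelevant)
open import Function using (_∘_)
open import Function.Bundles using (_↔_; Inverse; Injection; mk↔ₛ′)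
open import Function.Properties.Inverse using (↔-trans; ↔-sym; ↔-refl; ↔⇒↣)
open import Function.Related.TypeIsomorphisms using (Σ-assoc; ×-comm)

private
  variable
    A B : Set
    k m n : ℕ

×-irrelevant : Irrelevant A → Irrelevant B → Irrelevant (A × B)
×-irrelevant irrA irrB (a , b) (a' , b') rewrite irrA a a' | irrB b b' = refl

prop-↔ : Irrelevant A → Irrelevant B → (A → B) → (B → A) → A ↔ B
prop-↔ irrA irrB f g = mk↔ₛ′ f g (λ _ → irrB _ _) (λ _ → irrA _ _)

prop-×-↔ : A → Irrelevant A → (A × B) ↔ B
prop-×-↔ a irrA = mk↔ₛ′ proj₂ (a ,_) (λ _ → refl) (λ { (a' , b) → cong (_, b) (irrA a a') })

size-↔ : A ↔ B → HasSize A n → HasSize B n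
size-↔ e h = ↔-trans h e

size-≡ : m ≡ n → HasSize A m → HasSize A n
size-≡ refl h = h

size-empty : ¬ A → HasSize A 0
size-empty ¬a = mk↔ₛ′ (λ ()) (λ a → ⊥-elim (¬a a)) (λ a → ⊥-elim (¬a a)) (λ ())

size-prop : A → Irrelevant A → HasSize A 1
size-prop a irrA = mk↔ₛ′ (λ _ → a) (λ _ → zero) (λ _ → irrA _ _) (λ { zero → refl })

size-⊎ : HasSize A m → HasSize B n → HasSize (A ⊎ B) (m + n)
size-⊎ a b = ↔-trans +↔⊎ (a ⊎-↔ b)

size-Σ : {C : A → Set} → HasSize A m → (∀ a → HasSize (C a) n) → HasSize (Σ A C) (m * n)
size-Σ a c = ↔-trans *↔× (Σ-↔ a (λ {x} → c (Inverse.to a x)))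

size-one-elem : HasSize A 1 → A
size-one-elem h = Inverse.to h zero

size-one-irrelevant : HasSize A 1 → Irrelevant A
size-one-irrelevant h x y = trans (sym (strictlyInverseʳ x)) (strictlyInverseʳ y)
  where open Inverse (↔-trans (↔-sym h) 1↔⊤)

unInj₂ : (s : A ⊎ B) → (∀ a → s ≢ inj₁ a) → B
unInj₂ (inj₁ a) s∉A = ⊥-elim (s∉A a refl)
unInj₂ (inj₂ b) _   = b

unInj₂-correct : (s : A ⊎ B) (s∉A : ∀ a → s ≢ inj₁ a) → s ≡ inj₂ (unInj₂ s s∉A)
unInj₂-correct (inj₁ a) s∉A = ⊥-elim (s∉A a refl)
unInj₂-correct (inj₂ b) _   = refl

unInj₂-inj₂ : (s : A ⊎ B) (s∉A : ∀ a → s ≢ inj₁ a) {b : B} → s ≡ inj₂ b → unInj₂ s s∉A ≡ b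
unInj₂-inj₂ _ _ refl = refl

-- Removing a one-element summand: Fin (suc k) ↔ A ⊎ B with |A| = 1 gives
-- Fin k ↔ B, by punching out the position j₀ of the element of A.
size-remove-one : HasSize (A ⊎ B) (suc k) → HasSize A 1 → HasSize B k
size-remove-one {A} {B} {k} e oneA = mk↔ₛ′ toB fromB toB∘fromB fromB∘toB
  where
  open Inverse e
  open ≡-Reasoning

  j₀ : Fin (suc k)
  j₀ = from (inj₁ (size-one-elem oneA))

  off-A : ∀ j a → to (punchIn j₀ j) ≢ inj₁ a
  off-A j a eq = punchInᵢ≢i j₀ j (begin
    punchIn j₀ j                 ≡⟨ strictlyInverseʳ (punchIn j₀ j) ⟨
    from (to (punchIn j₀ j))     ≡⟨ cong from eq ⟩
    from (inj₁ a)                ≡⟨ cong (from ∘ inj₁) (size-one-irrelevant oneA _ _) ⟩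
    j₀                           ∎)

  j₀-off-B : ∀ b → j₀ ≢ from (inj₂ b)
  j₀-off-B b eq with trans (sym (strictlyInverseˡ _)) (trans (cong to eq) (strictlyInverseˡ (inj₂ b)))
  ... | ()

  toB : Fin k → B
  toB j = unInj₂ (to (punchIn j₀ j)) (off-A j)

  fromB : B → Fin k
  fromB b = punchOut (j₀-off-B b)

  toB∘fromB : ∀ b → toB (fromB b) ≡ b
  toB∘fromB b = unInj₂-inj₂ _ _
    (trans (cong to (punchIn-punchOut (j₀-off-B b))) (strictlyInverseˡ (inj₂ b)))

  fromB∘toB : ∀ j → fromB (toB j) ≡ j
  fromB∘toB j = trans
    (punchOut-cong j₀ (begin
      from (inj₂ (toB j))       ≡⟨ cong from (unInj₂-correct _ (off-A j)) ⟨
      from (to (punchIn j₀ j))  ≡⟨ strictlyInverseʳ (punchIn j₀ j) ⟩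
      punchIn j₀ j              ∎))
    (punchOut-punchIn j₀)

module _ {A : Set} {P : A → Set} (P? : Decidable P) where

  Σ-split : {C : A → Set} → Σ A C ↔ (Σ A (λ a → True (P? a) × C a) ⊎ Σ A (λ a → False (P? a) × C a))
  Σ-split {C} = mk↔ₛ′ to from to∘from from∘to
    where
    Yes No : Set
    Yes = Σ A (λ a → True (P? a) × C a)
    No  = Σ A (λ a → False (P? a) × C a)

    route : ∀ a → C a → Dec (P a) → Yes ⊎ No
    route a c (yes p) = inj₁ (a , fromWitness p , c)
    route a c (no ¬p) = inj₂ (a , fromWitnessFalse ¬p , c)

    to : Σ A C → Yes ⊎ No
    to (a , c) = route a c (P? a)

    from : Yes ⊎ No → Σ A C
    from (inj₁ (a , _ , c)) = a , c
    from (inj₂ (a , _ , c)) = a , c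

    route-yes : ∀ a c (t : True (P? a)) d → P? a ≡ d → route a c d ≡ inj₁ (a , t , c)
    route-yes a c t (yes p) _  = cong (λ t′ → inj₁ (a , t′ , c)) (T-irrelevant _ _)
    route-yes a c t (no ¬p) eq = ⊥-elim (subst True eq t)

    route-no : ∀ a c (f : False (P? a)) d → P? a ≡ d → route a c d ≡ inj₂ (a , f , c)
    route-no a c f (yes p) eq = ⊥-elim (subst False eq f)
    route-no a c f (no ¬p) _  = cong (λ f′ → inj₂ (a , f′ , c)) (T-irrelevant _ _)

    to∘from : ∀ s → to (from s) ≡ s
    to∘from (inj₁ (a , t , c)) = route-yes a c t (P? a) refl
    to∘from (inj₂ (a , f , c)) = route-no a c f (P? a) refl

    route-from : ∀ a c d → from (route a c d) ≡ (a , c)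
    route-from a c (yes p) = refl
    route-from a c (no ¬p) = refl

    from∘to : ∀ s → from (to s) ≡ s
    from∘to (a , c) = route-from a c (P? a)

  Σ-↔-by-cases : {C D : A → Set}
    → Σ A (λ a → True (P? a) × C a) ↔ Σ A (λ a → True (P? a) × D a)
    → (∀ a → ¬ P a → C a ↔ D a)
    → Σ A C ↔ Σ A D
  Σ-↔-by-cases {C} {D} onP offP = ↔-trans (Σ-split {C}) (↔-trans (onP ⊎-↔ offP′) (↔-sym (Σ-split {D})))
    where
    offP′ : Σ A (λ a → False (P? a) × C a) ↔ Σ A (λ a → False (P? a) × D a)
    offP′ = Σ-↔ ↔-refl (λ {a} → Σ-↔ ↔-refl (λ {f} → offP a (toWitnessFalse f)))

module _ {A : Set} (_≟ᴬ_ : DecidableEquality A) {C : A → Set} (a₀ : A) where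

  Σ-at : Σ A (λ a → True (a ≟ᴬ a₀) × C a) ↔ C a₀
  Σ-at = mk↔ₛ′ to from to∘from from∘to
    where
    to : Σ A (λ a → True (a ≟ᴬ a₀) × C a) → C a₀
    to (a , t , c) = subst C (toWitness t) c

    from : C a₀ → Σ A (λ a → True (a ≟ᴬ a₀) × C a)
    from c = a₀ , fromWitness refl , c

    to∘from : ∀ c → to (from c) ≡ c
    to∘from c = cong (λ e → subst C e c) (≡-irrelevant _ refl)

    from-subst : ∀ a (e : a ≡ a₀) (t : True (a ≟ᴬ a₀)) c → from (subst C e c) ≡ (a , t , c)
    from-subst a refl t c = cong (λ t′ → a₀ , t′ , c) (T-irrelevant _ _)

    from∘to : ∀ s → from (to s) ≡ s
    from∘to (a , t , c) = from-subst a (toWitness t) t c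

  Σ-split-at : Σ A C ↔ (C a₀ ⊎ Σ A (λ a → False (a ≟ᴬ a₀) × C a))
  Σ-split-at = ↔-trans (Σ-split (_≟ᴬ a₀)) (Σ-at ⊎-↔ ↔-refl)

  size-at-only : HasSize (C a₀) m → (∀ a → False (a ≟ᴬ a₀) → ¬ C a) → HasSize (Σ A C) m
  size-at-only {m} h vanish = size-↔ (↔-sym Σ-split-at)
    (size-≡ (+-identityʳ m) (size-⊎ h (size-empty (λ { (a , f , c) → vanish a f c }))))

Σ-⊤ : A ↔ Σ A (λ _ → ⊤)
Σ-⊤ = mk↔ₛ′ (_, tt) proj₁ (λ _ → refl) (λ _ → refl)

Σ-regroup : {X Y Z : A → Set} → Σ A (λ a → X a × Y a × Z a) ↔ Σ (Σ A (λ a → X a × Y a)) (Z ∘ proj₁)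
Σ-regroup = mk↔ₛ′ (λ { (a , x , y , z) → (a , x , y) , z }) (λ { ((a , x , y) , z) → a , x , y , z })
                  (λ _ → refl) (λ _ → refl)

Fin-injective⇒surjective : (f : Fin m → Fin m) → Injective _≡_ _≡_ f → ∀ y → ∃ λ x → f x ≡ y
Fin-injective⇒surjective f f-inj y with any? (λ x → f x ≟ y)
... | yes hit = hit
Fin-injective⇒surjective {suc m} f f-inj y | no miss =
  ⊥-elim (≤⇒≯ (injective⇒≤ {f = f′} f′-inj) (n<1+n m))
  where
  y-missed : ∀ x → y ≢ f x
  y-missed x eq = miss (x , sym eq)
  f′ : Fin (suc m) → Fin m
  f′ x = punchOut (y-missed x)
  f′-inj : Injective _≡_ _≡_ f′
  f′-inj eq = f-inj (punchOut-injective (y-missed _) (y-missed _) eq)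

∈-irrelevant : {x : Fin n} {S : Subset n} → Irrelevant (x ∈ S)
∈-irrelevant = []=-irrelevant

∈-∷-↔ : {x : Bool} {S : Subset n} → Σ (Fin (suc n)) (_∈ (x ∷ S)) ↔ ((x ≡ inside) ⊎ Σ (Fin n) (_∈ S))
∈-∷-↔ = mk↔ₛ′ to from to∘from from∘to
  where
  to : Σ (Fin (suc _)) (_∈ (_ ∷ _)) → _
  to (zero  , here)    = inj₁ refl
  to (suc i , there m) = inj₂ (i , m)
  from : _ → Σ (Fin (suc _)) (_∈ (_ ∷ _))
  from (inj₁ refl)        = zero , here
  from (inj₂ (i , m))     = suc i , there m
  to∘from : ∀ s → to (from s) ≡ s
  to∘from (inj₁ refl)     = refl
  to∘from (inj₂ (i , m))  = refl
  from∘to : ∀ s → from (to s) ≡ s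
  from∘to (zero  , here)    = refl
  from∘to (suc i , there m) = refl

members-size : (S : Subset n) → HasSize (Σ (Fin n) (_∈ S)) ∣ S ∣
members-size []            = size-empty (λ { (() , _) })
members-size (inside ∷ S)  = size-↔ (↔-sym ∈-∷-↔) (size-⊎ (size-prop refl ≡-irrelevant) (members-size S))
members-size (outside ∷ S) = size-↔ (↔-sym ∈-∷-↔) (size-⊎ (size-empty (λ ())) (members-size S))

∈-tabulate⁻ : {P : Fin n → Set} (P? : Decidable P) {i : Fin n} → i ∈ tabulate (does ∘ P?) → P i
∈-tabulate⁻ P? {i} m = answer (P? i) (trans (sym (lookup∘tabulate (does ∘ P?) i)) ([]=⇒lookup m))
  where
  answer : {X : Set} (d : Dec X) → does d ≡ true → X
  answer (yes x) _ = x
  answer (no _) ()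

∈-tabulate⁺ : {P : Fin n → Set} (P? : Decidable P) {i : Fin n} → P i → i ∈ tabulate (does ∘ P?)
∈-tabulate⁺ P? {i} p = lookup⇒[]= i _ (trans (lookup∘tabulate (does ∘ P?) i) (dec-true (P? i) p))

rq∸r : ∀ r q' → r * suc q' ∸ r ≡ r * q'
rq∸r r q' = trans (cong (_∸ r) (*-suc r q')) (m+n∸m≡n r (r * q'))

vertices-identity : ∀ r' q' → suc r' * suc q' * (q' * suc q') ≡ suc r' * (suc q' * (suc q' * 1)) * q'
vertices-identity = solve-∀

in-degree-identity : ∀ r q' → r * (q' * suc q') ≡ r * suc q' * q'
in-degree-identity = solve-∀

mutual-identity : ∀ r' q' → suc q' + r' * q' ≡ suc r' * suc q' ∸ suc r' + 1
mutual-identity r' q' = trans (regroup r' q') (cong (_+ 1) (sym (rq∸r (suc r') q')))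
  where
  regroup : ∀ r' q' → suc q' + r' * q' ≡ suc r' * q' + 1
  regroup = solve-∀

-- λ: r'q' = rq - r - q + 1, where r = a + 2 and q = b + 2 make the truncated
-- subtractions exact.
arc-identity : ∀ a b → suc a * suc b ≡ (2 + a) * (2 + b) ∸ (2 + a) ∸ (2 + b) + 1
arc-identity a b = begin
  suc a * suc b                                  ≡⟨ expand a b ⟩
  (2 + b) + (a * suc b + b) ∸ (2 + b) + 1        ≡⟨ cong (λ x → x ∸ (2 + b) + 1) (regroup a b) ⟨
  (2 + a) * suc b ∸ (2 + b) + 1                  ≡⟨ cong (λ x → x ∸ (2 + b) + 1) (rq∸r (2 + a) (suc b)) ⟨
  (2 + a) * (2 + b) ∸ (2 + a) ∸ (2 + b) + 1      ∎
  where
  open ≡-Reasoning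
  regroup : ∀ a b → (2 + a) * suc b ≡ (2 + b) + (a * suc b + b)
  regroup = solve-∀
  expand : ∀ a b → suc a * suc b ≡ (2 + b) + (a * suc b + b) ∸ (2 + b) + 1
  expand a b = trans (shift a b) (cong (_+ 1) (sym (m+n∸m≡n (2 + b) (a * suc b + b))))
    where
    shift : ∀ a b → suc a * suc b ≡ (a * suc b + b) + 1
    shift = solve-∀

IsDSRG-cong : {V : Set} {_⇒_ : V → V → Set} {v v′ d d′ t t′ l l′ μ μ′ : ℕ}
  → v ≡ v′ → d ≡ d′ → t ≡ t′ → l ≡ l′ → μ ≡ μ′
  → IsDSRG V _⇒_ v d t l μ → IsDSRG V _⇒_ v′ d′ t′ l′ μ′
IsDSRG-cong refl refl refl refl refl dsrg = dsrg

module Design {r' q' w : ℕ}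
  (group : Fin (suc r' * suc q') → Fin (suc r'))
  (group-size : ∀ h → ∣ Grp group h ∣ ≡ suc q')
  (partB : Fin (suc r' * suc q') → Fin w → Fin (suc q') → Subset (suc r' * suc q'))
  (partition : IsBlockPartition group partB)
  where

  open IsBlockPartition partition

  r q : ℕ
  r = suc r'
  q = suc q'

  Point : Set
  Point = Fin (r * q)

  ∈Grp⁻ : ∀ {p h} → p ∈ Grp group h → group p ≡ h
  ∈Grp⁻ {h = h} = ∈-tabulate⁻ (λ p → group p ≟ h)

  ∈Grp⁺ : ∀ {p h} → group p ≡ h → p ∈ Grp group h
  ∈Grp⁺ {h = h} = ∈-tabulate⁺ (λ p → group p ≟ h)

  group-members : ∀ h → HasSize (Σ Point λ p → group p ≡ h) q
  group-members h = size-≡ (group-size h)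
    (size-↔ (Σ-↔ ↔-refl (prop-↔ ∈-irrelevant ≡-irrelevant ∈Grp⁻ ∈Grp⁺)) (members-size (Grp group h)))

  block-meets-group : ∀ {B} → IsBlock group B → ∀ h → HasSize (Σ Point λ p → p ∈ B × group p ≡ h) 1
  block-meets-group {B} isB h = size-≡ (isB h) (size-↔ (Σ-↔ ↔-refl (prop-↔ ∈-irrelevant
      (×-irrelevant ∈-irrelevant ≡-irrelevant)
      (λ m → let (m₁ , m₂) = x∈p∩q⁻ B (Grp group h) m in m₁ , ∈Grp⁻ m₂)
      (λ (m₁ , e) → x∈p∩q⁺ (m₁ , ∈Grp⁺ e))))
    (members-size (B ∩ Grp group h)))

  block-point-unique : ∀ {B p p′} → IsBlock group B → p ∈ B → p′ ∈ B → group p ≡ group p′ → p ≡ p′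
  block-point-unique {p′ = p′} isB m m′ e =
    cong proj₁ (size-one-irrelevant (block-meets-group isB (group p′)) (_ , m , e) (p′ , m′ , refl))

  block-size : ∀ {B} → IsBlock group B → HasSize (Σ Point (_∈ B)) r
  block-size {B} isB = size-↔ by-group (size-≡ (*-identityʳ r) (size-Σ ↔-refl (block-meets-group isB)))
    where
    by-group : Σ (Fin r) (λ h → Σ Point λ p → p ∈ B × group p ≡ h) ↔ Σ Point (_∈ B)
    by-group = mk↔ₛ′ (λ (_ , p , m , _) → p , m) (λ (p , m) → group p , p , m , refl)
                     (λ _ → refl) (λ { (_ , p , m , refl) → refl })

  Mate : Point → Point → Set
  Mate i g = (group i ≡ group g) × False (i ≟ g)

  Mate-irrelevant : ∀ {i g} → Irrelevant (Mate i g)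
  Mate-irrelevant = ×-irrelevant ≡-irrelevant T-irrelevant

  Mate-sym : ∀ {i g} → Mate i g ↔ Mate g i
  Mate-sym = prop-↔ Mate-irrelevant Mate-irrelevant flip flip
    where
    flip : ∀ {i g} → Mate i g → Mate g i
    flip (e , f) = sym e , fromWitnessFalse (toWitnessFalse f ∘ sym)

  mates-size : ∀ g → HasSize (Σ Point λ i → Mate i g) q'
  mates-size g = size-↔ (Σ-↔ ↔-refl (×-comm _ _))
    (size-remove-one (size-↔ (Σ-split-at _≟_ g) (group-members (group g))) (size-prop refl ≡-irrelevant))

  mates-size′ : ∀ i → HasSize (Σ Point λ g → Mate i g) q'
  mates-size′ i = size-↔ (Σ-↔ ↔-refl Mate-sym) (mates-size i)

  Hits : Point → Point → Fin w → Set
  Hits g i j = Σ (Fin q) λ k → g ∈ partB i j k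

  -- Every block of the part (i , j) contains i ...
  hits-self : ∀ g j → HasSize (Hits g g j) q
  hits-self g j = mk↔ₛ′ (λ k → k , proj₂ (inBi g j k)) proj₁
    (λ (k , _) → cong (k ,_) (∈-irrelevant _ _)) (λ _ → refl)

  -- ... so none contains another point of i's group ...
  hits-mate : ∀ {g i} j → Mate i g → ¬ Hits g i j
  hits-mate j (e , f) (k , m) =
    toWitnessFalse f (block-point-unique (proj₁ (inBi _ j k)) (proj₂ (inBi _ j k)) m e)

  part-block-unique : ∀ {p i j k k′} → group p ≢ group i
    → p ∈ partB i j k → p ∈ partB i j k′ → k ≡ k′
  part-block-unique {p} {i} {j} {k} {k′} apart m m′ with k ≟ k′
  ... | yes k≡k′ = k≡k′
  ... | no  k≢k′ = ⊥-elim (apart (cong group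
          (x∈⁅y⁆⇒x≡y i (subst (p ∈_) (meet i j k k′ k≢k′) (x∈p∩q⁺ (m , m′))))))

  -- A point g outside i's group lies on exactly one block of the part
  -- (i , j): the q blocks meet g's group in q distinct points, i.e. in all
  -- of them.
  hits-apart : ∀ {g i} j → group i ≢ group g → HasSize (Hits g i j) 1
  hits-apart {g} {i} j apart = size-prop hit unique
    where
    members : HasSize (Σ Point λ p → group p ≡ group g) q
    members = group-members (group g)

    from-injective : Injective _≡_ _≡_ (Inverse.from members)
    from-injective = Injection.injective (↔⇒↣ (↔-sym members))

    meeting : (k : Fin q) → Σ Point λ p → p ∈ partB i j k × group p ≡ group g
    meeting k = size-one-elem (block-meets-group (proj₁ (inBi i j k)) (group g))

    index : Fin q → Fin q
    index k = let (p , _ , e) = meeting k in Inverse.from members (p , e)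

    index-injective : Injective _≡_ _≡_ index
    index-injective {k} {k′} eq with meeting k | meeting k′ | from-injective eq
    ... | p , on-k , in-group | .p , on-k′ , _ | refl = part-block-unique (apart ∘ sym ∘ trans (sym in-group)) on-k on-k′

    hit : Hits g i j
    hit with Fin-injective⇒surjective index index-injective (Inverse.from members (g , refl))
    ... | k , eq = k , subst (_∈ partB i j k) (cong proj₁ (from-injective eq)) (proj₁ (proj₂ (meeting k)))

    unique : Irrelevant (Hits g i j)
    unique (k , m) (k′ , m′) with part-block-unique (apart ∘ sym) m m′
    ... | refl = cong (k ,_) (∈-irrelevant m m′)

  module Digraph (π : Point → Fin w) where

    -- The pairs (i , k) with g ∈ 𝓑_{i,π(i),k}: q of them with i = g, none
    -- with i another point of g's group, one for each i outside it; so the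
    -- total equals the number of points.
    hits-total : ∀ g → HasSize (Σ Point λ i → Hits g i (π i)) (r * q)
    hits-total g = size-↔ (Σ-↔-by-cases same? in-group apart) (size-↔ Σ-⊤ ↔-refl)
      where
      same? : Decidable (λ i → group i ≡ group g)
      same? i = group i ≟ group g

      group-part : HasSize (Σ Point λ i → True (same? i) × ⊤) q
      group-part = size-↔ (Σ-↔ ↔-refl (prop-↔ ≡-irrelevant (×-irrelevant T-irrelevant (λ _ _ → refl))
        (λ e → fromWitness e , tt) (toWitness ∘ proj₁))) (group-members (group g))

      hits-part : HasSize (Σ Point λ i → True (same? i) × Hits g i (π i)) q
      hits-part = size-at-only _≟_ g (size-↔ (↔-sym (prop-×-↔ (fromWitness refl) T-irrelevant)) (hits-self g (π g)))
        (λ i f (t , h) → hits-mate (π i) (toWitness t , f) h)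

      in-group : Σ Point (λ i → True (same? i) × ⊤) ↔ Σ Point (λ i → True (same? i) × Hits g i (π i))
      in-group = ↔-trans (↔-sym group-part) hits-part

      apart : ∀ i → group i ≢ group g → ⊤ ↔ Hits g i (π i)
      apart i ne = ↔-trans (↔-sym 1↔⊤) (hits-apart (π i) ne)

    -- The vertices (g′ , B) with g ∈ B, described by B = 𝓑_{i,π(i),k}.
    Relay : Point → Point → Set
    Relay g g′ = Σ Point λ i → Mate i g′ × Hits g i (π i)

    relay-self : ∀ g → ¬ Relay g g
    relay-self g (i , mate , h) = hits-mate (π i) mate h

    relay-apart : ∀ {g g′} → group g′ ≢ group g → HasSize (Relay g g′) q'
    relay-apart {g} {g′} apart = size-≡ (*-identityʳ q') (size-↔ (Σ-assoc {C = λ i _ → Hits g i (π i)})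
      (size-Σ (mates-size g′) (λ (i , e , _) → hits-apart (π i) (apart ∘ trans (sym e)))))

    -- for a mate g′ of g only i = g contributes
    relay-mate : ∀ {g g′} → Mate g′ g → HasSize (Relay g g′) q
    relay-mate {g} {g′} mate = size-at-only _≟_ g
      (size-↔ (↔-sym (prop-×-↔ (Inverse.to Mate-sym mate) Mate-irrelevant)) (hits-self g (π g)))
      (λ i f ((e , _) , h) → hits-mate (π i) (trans e (proj₁ mate) , f) h)

    -- The two-paths from a vertex with point g to a vertex with block B,
    -- indexed by the point g′ ∈ B of their middle vertex.
    Paths : Point → Subset (r * q) → Set
    Paths g B = Σ Point λ g′ → g′ ∈ B × Relay g g′

    -- The point of B in g's group contributes c, the r' others q' each.
    paths-count : ∀ {g B c} → IsBlock group B
      → (∀ g′ → g′ ∈ B → group g′ ≡ group g → HasSize (Relay g g′) c)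
      → HasSize (Paths g B) (c + r' * q')
    paths-count {g} {B} {c} isB in-group = size-↔ (↔-sym (Σ-split same?)) (size-⊎
      (size-≡ (+-identityʳ c) (size-↔ (↔-sym Σ-regroup)
        (size-Σ meets (λ (g′ , t , m) → in-group g′ m (toWitness t)))))
      (size-↔ (↔-sym Σ-regroup) (size-Σ others (λ (_ , f , _) → relay-apart (toWitnessFalse f)))))
      where
      same? : Decidable (λ g′ → group g′ ≡ group g)
      same? g′ = group g′ ≟ group g

      meets : HasSize (Σ Point λ g′ → True (same? g′) × g′ ∈ B) 1
      meets = size-↔ (Σ-↔ ↔-refl (prop-↔ (×-irrelevant ∈-irrelevant ≡-irrelevant) (×-irrelevant T-irrelevant ∈-irrelevant)
        (λ (m , e) → fromWitness e , m) (λ (t , m) → m , toWitness t))) (block-meets-group isB (group g))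

      others : HasSize (Σ Point λ g′ → False (same? g′) × g′ ∈ B) r'
      others = size-remove-one (size-↔ (Σ-split same?) (block-size isB)) meets

    paths-arc : ∀ {g B} → IsBlock group B → g ∈ B → HasSize (Paths g B) (r' * q')
    paths-arc {g} isB g∈B = paths-count isB (λ g′ m e →
      size-empty (relay-self g ∘ subst (Relay g) (block-point-unique isB m g∈B e)))

    paths-nonarc : ∀ {g B} → IsBlock group B → g ∉ B → HasSize (Paths g B) (q + r' * q')
    paths-nonarc {g} {B} isB g∉B = paths-count isB (λ g′ m e →
      relay-mate (e , fromWitnessFalse (λ g′≡g → g∉B (subst (_∈ B) g′≡g m))))

    V : Set
    V = DVertex group partB π

    _⇒_ : V → V → Set
    _⇒_ = DArc group partB π

    point : V → Point
    point = proj₁ ∘ proj₁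

    block : V → Subset (r * q)
    block = proj₂ ∘ proj₁

    -- The vertex (g , 𝓑_{i,π(i),k}) described by (g , i , k).
    Described : (Point → Subset (r * q) → Set) → Set
    Described Q = Σ Point λ g → Σ Point λ i → Mate i g × Σ (Fin q) λ k → Q g (partB i (π i) k)

    describe : (Q : Point → Subset (r * q) → Set) → Σ V (λ x → Q (point x) (block x)) ↔ Described Q
    describe Q = mk↔ₛ′
      (λ { (((g , _) , i , e , f , k , refl) , x) → g , i , (e , f) , k , x })
      (λ { (g , i , (e , f) , k , x) → ((g , partB i (π i) k) , i , e , f , k , refl) , x })
      (λ _ → refl) (λ { (((g , _) , i , e , f , k , refl) , x) → refl })

    vertex-block : (x : V) → IsBlock group (block x)
    vertex-block ((g , _) , i , _ , _ , k , refl) = proj₁ (inBi i (π i) k)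

    no-loop : (x : V) → point x ∉ block x
    no-loop ((g , _) , i , e , f , k , refl) g∈B = hits-mate (π i) (e , f) (k , g∈B)

    vertex-count : HasSize V (r * q * (q' * q))
    vertex-count = size-↔ (↔-sym (↔-trans Σ-⊤ (describe (λ _ _ → ⊤))))
      (size-Σ ↔-refl (λ g → size-↔ Σ-assoc (size-Σ (mates-size g) (λ _ → size-↔ Σ-⊤ ↔-refl))))

    -- Out-neighbours of x: a block 𝓑_{i,π(i),k} through point x, then a mate of i.
    out-degree : ∀ x → HasSize (Σ V (x ⇒_)) (r * q * q')
    out-degree x = size-↔ (↔-sym (↔-trans (describe (λ _ B → point x ∈ B)) by-hit))
      (size-Σ (hits-total (point x)) (λ (i , _) → mates-size′ i))
      where
      by-hit : Described (λ _ B → point x ∈ B) ↔ Σ (Σ Point λ i → Hits (point x) i (π i)) (λ s → Σ Point (Mate (proj₁ s)))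
      by-hit = mk↔ₛ′ (λ (g , i , mate , k , m) → (i , k , m) , g , mate)
                     (λ ((i , k , m) , g , mate) → g , i , mate , k , m) (λ _ → refl) (λ _ → refl)

    -- In-neighbours of x: a point g of block x, a mate i of g, and any k.
    in-degree : ∀ x → HasSize (Σ V (_⇒ x)) (r * q * q')
    in-degree x = size-≡ (in-degree-identity r q') (size-↔ (↔-sym (↔-trans (describe (λ g _ → g ∈ block x)) by-point))
      (size-Σ (block-size (vertex-block x)) (λ (g , _) → size-↔ Σ-assoc (size-Σ (mates-size g) (λ _ → ↔-refl)))))
      where
      by-point : Described (λ g _ → g ∈ block x) ↔ Σ (Σ Point (_∈ block x)) (λ s → Σ Point λ i → Mate i (proj₁ s) × Fin q)
      by-point = mk↔ₛ′ (λ (g , i , mate , k , m) → (g , m) , i , mate , k)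
                       (λ ((g , m) , i , mate , k) → g , i , mate , k , m) (λ _ → refl) (λ _ → refl)

    two-paths : ∀ g B → Σ V (λ z → (g ∈ block z) × (point z ∈ B)) ↔ Paths g B
    two-paths g B = ↔-trans (describe (λ g′ B′ → (g ∈ B′) × (g′ ∈ B)))
      (mk↔ₛ′ (λ (g′ , i , mate , k , m , m′) → g′ , m′ , i , mate , k , m)
             (λ (g′ , m′ , i , mate , k , m) → g′ , i , mate , k , m , m′) (λ _ → refl) (λ _ → refl))

    isDSRG : IsDSRG V _⇒_ (r * q * (q' * q)) (r * q * q') (q + r' * q') (r' * q') (q + r' * q')
    isDSRG = record
      { size     = vertex-count
      ; loopless = no-loop
      ; outdeg   = out-degree
      ; indeg    = in-degree
      ; mutualN  = λ x → size-↔ (↔-sym (two-paths (point x) (block x)))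
                           (paths-nonarc (vertex-block x) (no-loop x))
      ; pathsArc = λ x y _ x⇒y → size-↔ (↔-sym (two-paths (point x) (block y)))
                                   (paths-arc (vertex-block y) x⇒y)
      ; pathsNon = λ x y _ x⇏y → size-↔ (↔-sym (two-paths (point x) (block y)))
                                   (paths-nonarc (vertex-block y) x⇏y)
      }

mainTheorem5 : (r q : ℕ) → 2 ≤ r → 2 ≤ q → r ≤ q ^ (r ∸ 3)
    → (group : Fin (r * q) → Fin r) → (∀ i → ∣ Grp group i ∣ ≡ q)
    → (partB : Fin (r * q) → Fin (q ^ (r ∸ 2)) → Fin q → Subset (r * q))
    → IsBlockPartition group partB
    → (π : Fin (r * q) → Fin (q ^ (r ∸ 2))) → Injective _≡_ _≡_ π
    → IsDSRG (DVertex group partB π) (DArc group partB π)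
    (r * q ^ 2 * (q ∸ 1)) (r * q * (q ∸ 1)) (r * q ∸ r + 1) (r * q ∸ r ∸ q + 1) (r * q ∸ r + 1)
mainTheorem5 _ _ (s≤s (s≤s (z≤n {a}))) (s≤s (s≤s (z≤n {b}))) _ group group-size partB partition π _ =
  IsDSRG-cong (vertices-identity (suc a) (suc b)) refl (mutual-identity (suc a) (suc b))
              (arc-identity a b) (mutual-identity (suc a) (suc b))
              (Design.Digraph.isDSRG group group-size partB partition π)
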